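{- For every triple $\langle I,J,\alpha\rangle\in D\times D\times\omega_1$, the set $Z_{I,J,\alpha}$ has asymptotic density $0$.
   Context: An interval partition is $I=\langle i_n:n\in\omega\rangle$ with $i_0=0$, $i_n<i_{n+1}$, $I_n=[i_n,i_{n+1})$. $D$ is a family of interval partitions with $|D|\le\mathfrak{d}$ such that for each $J\in D$ and $k\in\omega$ there is $l_{J,k}\in\omega$ with $l_{J,k}>0$, $l_{J,k}\ge k$ and $|J_k|=2^{l_{J,k}}$, and such that for every interval partition $K$ there is $I\in D$ with: for all but finitely many $n$ there is $k>n$ with $K_k\subset I_n$. For each $J\in D$ fix sets $A_{J,k,\sigma}\subset J_k$ ($k\in\omega$, $\sigma\in 2^{\le l_{J,k}}$) such that for each $k$: for every $m\le l_{J,k}$, $\{A_{J,k,\sigma}:\sigma\in 2^m\}$ partitions $J_k$ into disjoint sets; $|A_{J,k,\sigma}|=2^{l_{J,k}-|\sigma|}$ and $A_{J,k,\tau}\subset A_{J,k,\sigma}$ when $\sigma\subset\tau$; distinct elements $i,j$ of $A_{J,k,\sigma}$ satisfy $|i-j|>2^{|\sigma|-1}$. Let $\mathcal{F}_J$ be the set of $f\in\omega^\omega$ such that for each $k$ and each $l<l_{J,k}$ there is $\sigma\in 2^{l+1}$ with $f^{ -1}(\{l\})\cap J_k=A_{J,k,\sigma}$, and there is $\tau\in 2^{l_{J,k}}$ with $f^{ -1}(\{l_{J,k}\})\cap J_k=A_{J,k,\tau}$; for $f\in\mathcal{F}_J$ and $l\le l_{J,k}$ let $\sigma_{f,k,l}\in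 2^l$ be the unique $\sigma$ with $A_{J,k,\sigma}=\{x\in J_k:f(x)\ge l\}$. Fix $\langle f_{J,\alpha}:\alpha<\omega_1\rangle$ with each $f_{J,\alpha}\in\mathcal{F}_J$ and such that for all $i,m\in\omega$ with $m\le 2^i$ and every $m$-element $F\subset\omega_1$ there is an infinite $B\subset\omega\setminus i$ such that $\sigma_{f_{J,\alpha},k,i}\ne\sigma_{f_{J,\beta},k,i}$ for all distinct $\alpha,\beta\in F$ and all $k\in B$. For $\langle I,J,\alpha,l\rangle\in D\times D\times\omega_1\times\omega$ let $Z_{I,J,\alpha,l}=\bigcup_{k\in I_l}\{x\in J_k: f_{J,\alpha}(x)\ge l\}$, and $Z_{I,J,\alpha}=\bigcup_{l\in\omega}Z_{I,J,\alpha,l}$. -}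

module Defs where

open import Data.Nat using (ℕ; zero; suc; _+_; _*_; _∸_; _^_; _≤_; _<_; _≥_; ∣_-_∣)
open import Data.Bool using (Bool)
open import Data.List using (List; length; _++_)
open import Data.Product using (Σ; _×_; ∃-syntax)
open import Relation.Nullary using (¬_)
open import Relation.Binary.PropositionalEquality using (_≡_; _≢_)
open import Function.Bundles using (_⇔_)

record IntervalPartition : Set where
  field
    pt    : ℕ → ℕ
    pt0   : pt 0 ≡ 0
    ptInc : ∀ n → pt n < pt (suc n)

_∈Block_of_ : ℕ → ℕ → IntervalPartition → Set
x ∈Block n of I = (pt n ≤ x) × (x < pt (suc n))
  where open IntervalPartition I

data CountBelow (P : ℕ → Set) : ℕ → ℕ → Set where
  cb-zero : CountBelow P 0 0
  cb-yes  : ∀ {n c} → P n → CountBelow P n c → CountBelow P (suc n) (suc c)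
  cb-no   : ∀ {n c} → ¬ P n → CountBelow P n c → CountBelow P (suc n) c

DensityZero : (ℕ → Set) → Set
DensityZero P =
  ∀ m → 1 ≤ m → ∃[ N ] (∀ n → N ≤ n → ∃[ c ] (CountBelow P n c × m * c ≤ n))

-- Binary sequences σ ∈ 2^{<ω} are lists of booleans; σ ⊆ τ means σ is a prefix of τ.
_⊑_ : List Bool → List Bool → Set
σ ⊑ τ = ∃[ ρ ] (τ ≡ σ ++ ρ)

-- An interval partition J from D together with the numbers l_{J,k} and the
-- fixed sets A_{J,k,σ} ⊆ J_k (σ ∈ 2^{≤ l_{J,k}}), with all their stated properties.
record StructuredPartition : Set₁ where
  field
    J      : IntervalPartition
    lev    : ℕ → ℕ
    levPos : ∀ k → 0 < lev k
    levGe  : ∀ k → k ≤ lev k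
    size   : ∀ k → IntervalPartition.pt J (suc k) ≡ IntervalPartition.pt J k + 2 ^ lev k
    A      : ℕ → List Bool → ℕ → Set
    A⊆J    : ∀ k σ x → length σ ≤ lev k → A k σ x → x ∈Block k of J
    cover  : ∀ k m x → m ≤ lev k → x ∈Block k of J →
             ∃[ σ ] (length σ ≡ m × A k σ x)
    disj   : ∀ k σ τ x → length σ ≤ lev k → length τ ≡ length σ →
             A k σ x → A k τ x → σ ≡ τ
    card   : ∀ k σ → length σ ≤ lev k →
             CountBelow (A k σ) (IntervalPartition.pt J (suc k)) (2 ^ (lev k ∸ length σ))
    mono   : ∀ k σ τ x → σ ⊑ τ → length τ ≤ lev k → A k τ x → A k σ x
    -- distinct i, j ∈ A_{J,k,σ} satisfy |i - j| > 2^{|σ|-1}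
    -- (for |σ| = 0 this only says i ≠ j, which is automatic)
    sep    : ∀ k σ x y m → length σ ≤ lev k → length σ ≡ suc m →
             A k σ x → A k σ y → x ≢ y → 2 ^ m < ∣ x - y ∣

InF : StructuredPartition → (ℕ → ℕ) → Set
InF S f =
  (∀ k l → l < lev k →
     ∃[ σ ] (length σ ≡ suc l × (∀ x → x ∈Block k of J → ((f x ≡ l) ⇔ A k σ x))))
  × (∀ k →
     ∃[ τ ] (length τ ≡ lev k × (∀ x → x ∈Block k of J → ((f x ≡ lev k) ⇔ A k τ x))))
  where open StructuredPartition S

Z : IntervalPartition → IntervalPartition → (ℕ → ℕ) → ℕ → Set
Z I J f x = ∃[ l ] ∃[ k ] (k ∈Block l of I × x ∈Block k of J × l ≤ f x)

-- Let k ∈ I_l.  On J_k the set Z is {x ∈ J_k : f x ≥ l} = A_{J,k,σ_{f,k,l}}, whose points are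
-- more than 2^{l-1} apart.  Once l > G the blocks J_k are longer than G as well, so every
-- window of length G beyond some point meets Z in at most two points (one on each side of
-- a block boundary), and Z has at most about 2n/G points below n.
module Submission where

open import Defs
open import Data.Nat using (ℕ; zero; suc; _+_; _*_; _∸_; _^_; _≤_; _<_; _≤′_; ≤′-refl; ≤′-step;
  z≤n; s≤s; s≤s⁻¹; _≤?_)
open import Data.Nat.Properties
open import Data.Nat.Induction using (<-rec)
open import Data.Nat.Solver using (module +-*-Solver)
open import Data.Bool using (Bool; not)
open import Data.Bool.Properties using (not-¬; ¬-not)
open import Data.List using (List; []; _∷_; length; _∷ʳ_; initLast; _∷ʳ′_)
open import Data.List.Properties using (∷ʳ-injective)
open import Data.Product using (_×_; ∃-syntax; _,_; proj₁; proj₂)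
open import Data.Sum using (inj₁; inj₂)
open import Function.Base using (_∘_)
open import Function.Bundles using (_⇔_; mk⇔; Equivalence)
open import Relation.Nullary using (¬_; yes; no; contradiction)
open import Relation.Nullary.Decidable using (map′)
open import Relation.Unary using (Decidable)
open import Relation.Binary.PropositionalEquality using (_≡_; _≢_; refl; sym; trans; cong; subst)

open Equivalence using (to; from)

n<2^n : ∀ n → n < 2 ^ n
n<2^n zero    = s≤s z≤n
n<2^n (suc n) = ≤-<-trans (n<2^n n) (^-monoʳ-< 2 (s≤s (s≤s z≤n)) (n<1+n n))

length-∷ʳ : ∀ {A : Set} (xs : List A) x → length (xs ∷ʳ x) ≡ suc (length xs)
length-∷ʳ []       x = refl
length-∷ʳ (_ ∷ xs) x = cong suc (length-∷ʳ xs x)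

CountBelow-witness : ∀ {P : ℕ → Set} {n c} → 0 < c → CountBelow P n c → ∃[ x ] P x
CountBelow-witness c>0 (cb-yes Px _) = _ , Px
CountBelow-witness c>0 (cb-no _ r)   = CountBelow-witness c>0 r

AtMostTwoPerWindow : (ℕ → Set) → ℕ → ℕ → Set
AtMostTwoPerWindow P B G =
  ∀ {x y z} → B ≤ x → x < y → y < z → P x → P y → P z → x + G ≤ z

module IntervalPartitionProperties (I : IntervalPartition) where
  open IntervalPartition I

  pt-mono-≤ : ∀ {a b} → a ≤ b → pt a ≤ pt b
  pt-mono-≤ = go ∘ ≤⇒≤′
    where
    go : ∀ {a b} → a ≤′ b → pt a ≤ pt b
    go ≤′-refl        = ≤-refl
    go (≤′-step a≤′b) = ≤-trans (go a≤′b) (<⇒≤ (ptInc _))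

  n≤pt : ∀ n → n ≤ pt n
  n≤pt zero    = z≤n
  n≤pt (suc n) = ≤-<-trans (n≤pt n) (ptInc n)

  block-exists : ∀ x → ∃[ k ] (x ∈Block k of I)
  block-exists x = search (suc x) (≤-<-trans (n≤pt x) (ptInc x))
    where
    search : ∀ n → x < pt n → ∃[ k ] (x ∈Block k of I)
    search zero    x<pt = contradiction (subst (x <_) pt0 x<pt) n≮0
    search (suc n) x<pt with pt n ≤? x
    ... | yes pt≤x = n , pt≤x , x<pt
    ... | no  pt≰x = search n (≰⇒> pt≰x)

  block-mono : ∀ {x y k k′} → x ≤ y → x ∈Block k of I → y ∈Block k′ of I → k ≤ k′
  block-mono {y = y} x≤y (pt≤x , _) (_ , y<pt) = ≮⇒≥ λ k′<k →
    n≮n y (<-≤-trans y<pt (≤-trans (pt-mono-≤ k′<k) (≤-trans pt≤x x≤y)))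

  block-after : ∀ {k x k′} → pt k ≤ x → x ∈Block k′ of I → k ≤ k′
  block-after {k} pt≤x = block-mono pt≤x (≤-refl , ptInc k)

  block-unique : ∀ {x k k′} → x ∈Block k of I → x ∈Block k′ of I → k ≡ k′
  block-unique x∈k x∈k′ = ≤-antisym (block-mono ≤-refl x∈k x∈k′) (block-mono ≤-refl x∈k′ x∈k)

  -- Two points of P in distinct non-adjacent blocks are a whole block apart.
  twoPerWindow-from-blocks : ∀ {P : ℕ → Set} k₀ G →
    (∀ {k} → k₀ ≤ k → pt k + G ≤ pt (suc k)) →
    (∀ {k x y} → k₀ ≤ k → x ∈Block k of I → y ∈Block k of I → x < y → P x → P y → x + G ≤ y) →
    AtMostTwoPerWindow P (pt k₀) G
  twoPerWindow-from-blocks k₀ G long sparse {x} {y} {z} k₀≤x x<y y<z Px Py Pz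
    with block-exists x | block-exists y | block-exists z
  ... | kx , x∈ | ky , y∈ | kz , z∈
    with m≤n⇒m<n∨m≡n (block-mono (<⇒≤ x<y) x∈ y∈) | m≤n⇒m<n∨m≡n (block-mono (<⇒≤ y<z) y∈ z∈)
  ... | inj₂ refl | _ =
    ≤-trans (sparse (block-after k₀≤x x∈) x∈ y∈ x<y Px Py) (<⇒≤ y<z)
  ... | inj₁ kx<ky | inj₂ refl =
    ≤-trans (+-monoˡ-≤ G (<⇒≤ x<y)) (sparse (≤-trans (block-after k₀≤x x∈) (<⇒≤ kx<ky)) y∈ z∈ y<z Py Pz)
  ... | inj₁ kx<ky | inj₁ ky<kz = <⇒≤ (begin-strict
    x + G          <⟨ +-monoˡ-< G (<-≤-trans (proj₂ x∈) (pt-mono-≤ kx<ky)) ⟩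
    pt ky + G      ≤⟨ long (≤-trans (block-after k₀≤x x∈) (<⇒≤ kx<ky)) ⟩
    pt (suc ky)    ≤⟨ pt-mono-≤ ky<kz ⟩
    pt kz          ≤⟨ proj₁ z∈ ⟩
    z              ∎)
    where open ≤-Reasoning

module Counting {P : ℕ → Set} (P? : Decidable P) where

  count : ℕ → ℕ
  count zero = 0
  count (suc n) with P? n
  ... | yes _ = suc (count n)
  ... | no  _ = count n

  count-correct : ∀ n → CountBelow P n (count n)
  count-correct zero = cb-zero
  count-correct (suc n) with P? n
  ... | yes Pn = cb-yes Pn (count-correct n)
  ... | no ¬Pn = cb-no ¬Pn (count-correct n)

  count-≤ : ∀ n → count n ≤ n
  count-≤ zero = z≤n
  count-≤ (suc n) with P? n
  ... | yes _ = s≤s (count-≤ n)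
  ... | no  _ = m≤n⇒m≤1+n (count-≤ n)

  count-≤-suc : ∀ n → count n ≤ count (suc n)
  count-≤-suc n with P? n
  ... | yes _ = n≤1+n _
  ... | no  _ = ≤-refl

  count-mono-≤ : ∀ {a b} → a ≤ b → count a ≤ count b
  count-mono-≤ = go ∘ ≤⇒≤′
    where
    go : ∀ {a b} → a ≤′ b → count a ≤ count b
    go ≤′-refl        = ≤-refl
    go (≤′-step a≤′b) = ≤-trans (go a≤′b) (count-≤-suc _)

  count-at : ∀ {x} → P x → count (suc x) ≡ suc (count x)
  count-at {x} Px with P? x
  ... | yes _  = refl
  ... | no ¬Px = contradiction Px ¬Px

  count≤⇒≤ : ∀ {a x} → P x → count a ≤ count x → a ≤ x
  count≤⇒≤ {a} {x} Px ca≤cx = ≮⇒≥ λ x<a →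
    n≮n (count x) (≤-trans (subst (_≤ count a) (count-at Px) (count-mono-≤ x<a)) ca≤cx)

  last-point : ∀ {k} n → k < count n → ∃[ x ] (x < n × P x × k ≤ count x)
  last-point (suc n) k<c with P? n
  ... | yes Pn = n , n<1+n n , Pn , s≤s⁻¹ k<c
  ... | no  _ with last-point n k<c
  ...   | x , x<n , Px , k≤cx = x , m<n⇒m<1+n x<n , Px , k≤cx

  module _ {B G : ℕ} (twoPerWindow : AtMostTwoPerWindow P B G) where

    count-window : ∀ {a} → B ≤ a → count (a + G) ≤ 2 + count a
    count-window {a} B≤a = ≮⇒≥ noThree
      where
      noThree : ¬ (2 + count a < count (a + G))
      noThree three with last-point (a + G) three
      ... | z , z<a+G , Pz , c₂ with last-point z c₂
      ... | y , y<z , Py , c₁ with last-point y c₁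
      ... | x , x<y , Px , c₀ = n≮n (x + G)
        (<-≤-trans (≤-<-trans (twoPerWindow (≤-trans B≤a a≤x) x<y y<z Px Py Pz) z<a+G)
                   (+-monoˡ-≤ G a≤x))
        where
        a≤x : a ≤ x
        a≤x = count≤⇒≤ Px c₀

    count-linear : 0 < G → ∀ n → G * count n ≤ 2 * n + G * (B + G)
    count-linear G>0 = <-rec Bound step
      where
      K : ℕ
      K = G * (B + G)

      Bound : ℕ → Set
      Bound n = G * count n ≤ 2 * n + K

      window-step : ∀ a → B ≤ a → Bound a → Bound (a + G)
      window-step a B≤a ih = begin
        G * count (a + G)     ≤⟨ *-monoʳ-≤ G (count-window B≤a) ⟩
        G * (2 + count a)     ≡⟨ *-distribˡ-+ G 2 (count a) ⟩
        G * 2 + G * count a   ≤⟨ +-monoʳ-≤ (G * 2) ih ⟩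
        G * 2 + (2 * a + K)   ≡⟨ solve 3 (λ g a k → g :* con 2 :+ (con 2 :* a :+ k) := con 2 :* (a :+ g) :+ k) refl G a K ⟩
        2 * (a + G) + K       ∎
        where
        open ≤-Reasoning
        open +-*-Solver

      step : ∀ n → (∀ {m} → m < n → Bound m) → Bound n
      step n ih with B + G ≤? n
      ... | no n<B+G = ≤-trans (*-monoʳ-≤ G (≤-trans (count-≤ n) (<⇒≤ (≰⇒> n<B+G)))) (m≤n+m K (2 * n))
      ... | yes B+G≤n = subst Bound a+G≡n (window-step a B≤a (ih (subst (a <_) a+G≡n (m<m+n a G>0))))
        where
        a : ℕ
        a = n ∸ G
        a+G≡n : a + G ≡ n
        a+G≡n = m∸n+n≡m (≤-trans (m≤n+m G B) B+G≤n)
        B≤a : B ≤ a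
        B≤a = subst (_≤ a) (m+n∸n≡m B G) (∸-monoˡ-≤ G B+G≤n)

densityZero-from-windows : ∀ {P : ℕ → Set} → Decidable P →
  (∀ G → ∃[ B ] AtMostTwoPerWindow P B G) → DensityZero P
densityZero-from-windows P? windows m 1≤m = K , λ n K≤n → count n , count-correct n , bound n K≤n
  where
  open Counting P?
  G B K : ℕ
  G = 4 * m
  B = proj₁ (windows G)
  K = G * (B + G)

  bound : ∀ n → K ≤ n → m * count n ≤ n
  bound n K≤n = *-cancelˡ-≤ 4 (begin
    4 * (m * count n)   ≡⟨ sym (*-assoc 4 m (count n)) ⟩
    G * count n         ≤⟨ count-linear (proj₂ (windows G)) (≤-trans 1≤m (m≤n*m m 4)) n ⟩
    2 * n + K           ≤⟨ +-monoʳ-≤ (2 * n) (≤-trans K≤n (m≤m+n n (n + 0))) ⟩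
    2 * n + 2 * n       ≡⟨ sym (*-distribʳ-+ n 2 2) ⟩
    4 * n               ∎)
    where open ≤-Reasoning

module StructuredPartitionProperties (S : StructuredPartition) where
  open StructuredPartition S

  A-root : ∀ {k x} → x ∈Block k of J → A k [] x
  A-root {k} {x} x∈ with cover k 0 x z≤n x∈
  ... | []    , _  , Ax = Ax
  ... | _ ∷ _ , () , _

  A-inhabited : ∀ {k σ} → length σ ≤ lev k → ∃[ x ] A k σ x
  A-inhabited {k} {σ} σ≤ = CountBelow-witness (m^n>0 2 (lev k ∸ length σ)) (card k σ σ≤)

  A-parent : ∀ {k σ ρ c x} → length (σ ∷ʳ c) ≤ lev k → length ρ ≡ length σ →
             A k (σ ∷ʳ c) x → A k ρ x → σ ≡ ρ
  A-parent {k} {σ} {ρ} {c} {x} σc≤ |ρ|≡|σ| Aσc Aρ =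
    disj k σ ρ x σ≤ |ρ|≡|σ| (mono k σ (σ ∷ʳ c) x (c ∷ [] , refl) σc≤ Aσc) Aρ
    where
    σ≤ : length σ ≤ lev k
    σ≤ = ≤-trans (n≤1+n _) (subst (_≤ lev k) (length-∷ʳ σ c) σc≤)

  A-child : ∀ {k ρ x} → length ρ < lev k → x ∈Block k of J → A k ρ x → ∃[ c ] A k (ρ ∷ʳ c) x
  A-child {k} {ρ} {x} ρ< x∈ Aρ with cover k (suc (length ρ)) x ρ< x∈
  ... | υ , |υ| , Aυ with initLast υ
  ...   | []      = contradiction |υ| λ ()
  ...   | σ ∷ʳ′ c = c , subst (λ τ → A k (τ ∷ʳ c) x) σ≡ρ Aυ
    where
    σ≡ρ : σ ≡ ρ
    σ≡ρ = A-parent (subst (_≤ lev k) (sym |υ|) ρ<)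
                   (sym (suc-injective (trans (sym (length-∷ʳ σ c)) |υ|))) Aυ Aρ

module SuperlevelSets (S : StructuredPartition) (f : ℕ → ℕ) (f∈F : InF S f) where
  open StructuredPartition S
  open StructuredPartitionProperties S

  IsSuperlevel : ℕ → ℕ → List Bool → Set
  IsSuperlevel k l ρ = length ρ ≡ l × (∀ x → x ∈Block k of J → (l ≤ f x ⇔ A k ρ x))

  IsLevel : ℕ → ℕ → List Bool → Set
  IsLevel k l σ = ∀ x → x ∈Block k of J → (f x ≡ l ⇔ A k σ x)

  -- A point of the nonempty level set lies in A_ρ, which forces the level set's parent to be ρ.
  level-set : ∀ {k l ρ} → l < lev k → IsSuperlevel k l ρ → ∃[ b ] IsLevel k l (ρ ∷ʳ b)
  level-set {k} {l} {ρ} l< (|ρ| , ρ-sup) with proj₁ f∈F k l l<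
  ... | σ , |σ| , σ-lev with initLast σ
  ...   | []       = contradiction |σ| λ ()
  ...   | σ′ ∷ʳ′ b = b , subst (λ τ → IsLevel k l (τ ∷ʳ b)) σ′≡ρ σ-lev
    where
    σ≤ : length (σ′ ∷ʳ b) ≤ lev k
    σ≤ = subst (_≤ lev k) (sym |σ|) l<

    y : ℕ
    y = proj₁ (A-inhabited σ≤)

    Ay : A k (σ′ ∷ʳ b) y
    Ay = proj₂ (A-inhabited σ≤)

    y∈ : y ∈Block k of J
    y∈ = A⊆J k (σ′ ∷ʳ b) y σ≤ Ay

    σ′≡ρ : σ′ ≡ ρ
    σ′≡ρ = A-parent σ≤ (trans |ρ| (sym (suc-injective (trans (sym (length-∷ʳ σ′ b)) |σ|))))
             Ay (to (ρ-sup y y∈) (≤-reflexive (sym (from (σ-lev y y∈) Ay))))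

  -- {f ≥ l+1} = {f ≥ l} ∖ {f = l} is the other child of ρ.
  superlevel : ∀ k l → l ≤ lev k → ∃[ ρ ] IsSuperlevel k l ρ
  superlevel k zero _ = [] , refl , λ x x∈ → mk⇔ (λ _ → A-root x∈) (λ _ → z≤n)
  superlevel k (suc l) l<lev with superlevel k l (<⇒≤ l<lev)
  ... | ρ , |ρ| , ρ-sup with level-set l<lev (|ρ| , ρ-sup)
  ...   | b , ρb-lev =
    ρ ∷ʳ not b , trans (length-∷ʳ ρ (not b)) (cong suc |ρ|) , λ x x∈ → mk⇔ (into x∈) (out-of x∈)
    where
    ρ< : length ρ < lev k
    ρ< = subst (_< lev k) (sym |ρ|) l<lev

    ρc≤ : ∀ c → length (ρ ∷ʳ c) ≤ lev k
    ρc≤ c = subst (_≤ lev k) (sym (length-∷ʳ ρ c)) ρ<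

    into : ∀ {x} → x ∈Block k of J → suc l ≤ f x → A k (ρ ∷ʳ not b) x
    into {x} x∈ l<fx with A-child ρ< x∈ (to (ρ-sup x x∈) (<⇒≤ l<fx))
    ... | c , Aρc = subst (λ c → A k (ρ ∷ʳ c) x) (¬-not c≢b) Aρc
      where
      c≢b : c ≢ b
      c≢b refl = <⇒≢ l<fx (sym (from (ρb-lev x x∈) Aρc))

    out-of : ∀ {x} → x ∈Block k of J → A k (ρ ∷ʳ not b) x → suc l ≤ f x
    out-of {x} x∈ Aρ¬b = ≤∧≢⇒< (from (ρ-sup x x∈) (mono k ρ (ρ ∷ʳ not b) x (_ , refl) (ρc≤ (not b)) Aρ¬b)) l≢fx
      where
      l≢fx : l ≢ f x
      l≢fx l≡fx = not-¬ refl (proj₂ (∷ʳ-injective ρ ρ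
        (disj k (ρ ∷ʳ b) (ρ ∷ʳ not b) x (ρc≤ b)
              (trans (length-∷ʳ ρ (not b)) (sym (length-∷ʳ ρ b)))
              (to (ρb-lev x x∈) (sym l≡fx)) Aρ¬b)))

module ZProperties (I : IntervalPartition) (S : StructuredPartition) (f : ℕ → ℕ) (f∈F : InF S f) where
  open StructuredPartition S
  open SuperlevelSets S f f∈F
  module PI = IntervalPartitionProperties I
  module PJ = IntervalPartitionProperties J
  open IntervalPartition I using () renaming (pt to ptI)
  open IntervalPartition J using () renaming (pt to ptJ)

  Z-level : ∀ {x k l} → x ∈Block k of J → k ∈Block l of I → Z I J f x → l ≤ f x
  Z-level x∈ k∈ (_ , _ , k′∈ , x∈′ , l′≤fx) with PJ.block-unique x∈′ x∈
  ... | refl with PI.block-unique k′∈ k∈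
  ...   | refl = l′≤fx

  Z? : Decidable (Z I J f)
  Z? x with PJ.block-exists x
  ... | k , x∈ with PI.block-exists k
  ...   | l , k∈ = map′ (λ l≤fx → l , k , k∈ , x∈ , l≤fx) (Z-level x∈ k∈) (l ≤? f x)

  index≤lev : ∀ {k l} → k ∈Block l of I → l ≤ lev k
  index≤lev {k} {l} (ptl≤k , _) = ≤-trans (PI.n≤pt l) (≤-trans ptl≤k (levGe k))

  -- Beyond J_{ptI (G+1)} the blocks of I have index l > G, so Z ∩ J_k is an A_{J,k,ρ} with |ρ| > G.
  Z-separated-in-block : ∀ G {k x y} → ptI (suc G) ≤ k → x ∈Block k of J → y ∈Block k of J →
    x < y → Z I J f x → Z I J f y → x + G ≤ y
  Z-separated-in-block G {k} {x} {y} k₀≤k x∈ y∈ x<y Zx Zy with PI.block-exists k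
  ... | l , k∈ with PI.block-after k₀≤k k∈
  ...   | s≤s {n = m} G≤m with superlevel k l (index≤lev k∈)
  ...     | ρ , |ρ| , ρ-sup = <⇒≤ (begin-strict
    x + G         <⟨ +-monoʳ-< x G<y∸x ⟩
    x + (y ∸ x)   ≡⟨ m+[n∸m]≡n (<⇒≤ x<y) ⟩
    y             ∎)
    where
    open ≤-Reasoning
    Aρ : ∀ {w} → w ∈Block k of J → Z I J f w → A k ρ w
    Aρ w∈ Zw = to (ρ-sup _ w∈) (Z-level w∈ k∈ Zw)

    G<y∸x : G < y ∸ x
    G<y∸x = begin-strict
      G        <⟨ n<2^n G ⟩
      2 ^ G    ≤⟨ ^-monoʳ-≤ 2 G≤m ⟩
      2 ^ m    <⟨ subst (2 ^ m <_) (m≤n⇒∣m-n∣≡n∸m (<⇒≤ x<y))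
                    (sep k ρ x y m (subst (_≤ lev k) (sym |ρ|) (index≤lev k∈)) |ρ| (Aρ x∈ Zx) (Aρ y∈ Zy) (<⇒≢ x<y)) ⟩
      y ∸ x    ∎

  J-blocks-long : ∀ G {k} → ptI (suc G) ≤ k → ptJ k + G ≤ ptJ (suc k)
  J-blocks-long G {k} k₀≤k = subst (ptJ k + G ≤_) (sym (size k)) (+-monoʳ-≤ (ptJ k) G≤2^lev)
    where
    G≤2^lev : G ≤ 2 ^ lev k
    G≤2^lev = ≤-trans (≤-trans (n≤1+n G) (≤-trans (PI.n≤pt (suc G)) k₀≤k))
                      (≤-trans (levGe k) (<⇒≤ (n<2^n (lev k))))

  Z-twoPerWindow : ∀ G → AtMostTwoPerWindow (Z I J f) (ptJ (ptI (suc G))) G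
  Z-twoPerWindow G = PJ.twoPerWindow-from-blocks (ptI (suc G)) G (J-blocks-long G) (Z-separated-in-block G)

lemma2p8 : (I : IntervalPartition) (S : StructuredPartition) (f : ℕ → ℕ) →
    InF S f → DensityZero (Z I (StructuredPartition.J S) f)
lemma2p8 I S f f∈F = densityZero-from-windows Z? (λ G → _ , Z-twoPerWindow G)
  where open ZProperties I S f f∈F
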